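{- Let $k\ge 1$ and $n$ be positive integers. For all $k$-connected graphs $G$ and $H$ each having at least $n$ vertices, the treewidth of the cartesian product $G\,\square\, H$ satisfies $$\operatorname{tw}(G\,\square\, H)\geq k(n-2k+2)-1.$$
   Context: All graphs are finite and simple. The cartesian product $G\,\square\,H$ of graphs $G$ and $H$ is the graph with vertex set $V(G)\times V(H)$, in which $(v,x)(w,y)$ is an edge if and only if either $vw\in E(G)$ and $x=y$, or $v=w$ and $xy\in E(H)$. A tree decomposition of a graph $G$ consists of a tree $T$ and sets (bags) $T_x\subseteq V(G)$ for $x\in V(T)$ such that every edge of $G$ has both endpoints in some bag, and for each vertex $v$ of $G$ the set $\{x\in V(T): v\in T_x\}$ induces a non-empty connected subtree of $T$. Its width is $\max_x |T_x|-1$, and the treewidth $\operatorname{tw}(G)$ is the minimum width of a tree decomposition of $G$. -}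

module Defs where

open import Data.Nat using (ℕ; zero; suc; _+_; _*_; _∸_; _≤_; _<_)
open import Data.Fin using (Fin)
open import Data.Fin.Properties using (*↔×)
open import Data.Fin.Subset using (Subset; ∣_∣) renaming (_∈_ to _∈ₛ_)
open import Data.Product using (Σ; ∃; _×_; _,_; proj₁; proj₂)
open import Data.Product.Function.NonDependent.Propositional using (_×-↔_)
open import Data.Sum using (_⊎_; inj₁; inj₂)
open import Data.Unit using (⊤)
open import Data.Empty using (⊥)
open import Data.List using (List; length)
open import Data.List.Membership.Propositional using (_∈_)
open import Relation.Nullary using (¬_)
open import Relation.Binary.PropositionalEquality using (_≡_; refl)
open import Function.Bundles using (_↔_; Inverse)
open import Function.Properties.Inverse using (↔-sym; ↔-trans)
open import Data.Integer as ℤ using (ℤ; +_)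

record Graph : Set₁ where
  field
    V     : Set
    size  : ℕ
    enum  : V ↔ Fin size
    E     : V → V → Set
    E-sym : ∀ {u v} → E u v → E v u
    E-irr : ∀ {v} → ¬ E v v

open Graph public

∣V∣ : Graph → ℕ
∣V∣ G = size G

data Walk (G : Graph) (P : V G → Set) : V G → V G → Set where
  here : ∀ {x} → P x → Walk G P x x
  step : ∀ {x y z} → P x → E G x y → Walk G P y z → Walk G P x z

-- the subgraph induced by the vertices satisfying P is connected
-- (non-emptiness is stated separately where needed)
InducedConnected : (G : Graph) → (V G → Set) → Set
InducedConnected G P = ∀ u v → P u → P v → Walk G P u v

Connected : Graph → Set
Connected G = (Σ (V G) λ _ → ⊤) × InducedConnected G (λ _ → ⊤)

KConnected : ℕ → Graph → Set
KConnected k G =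
  k < size G ×
  (∀ (S : List (V G)) → length S < k → InducedConnected G (λ w → ¬ (w ∈ S)))

record Cycle (G : Graph) : Set where
  field
    L      : ℕ
    3≤L    : 3 ≤ L
    c      : ℕ → V G
    c-inj  : ∀ i j → i < L → j < L → c i ≡ c j → i ≡ j
    c-step : ∀ i → suc i < L → E G (c i) (c (suc i))
    c-close : E G (c (L ∸ 1)) (c 0)

Acyclic : Graph → Set
Acyclic G = ¬ Cycle G

IsTree : Graph → Set
IsTree T = Connected T × Acyclic T

_□_ : Graph → Graph → Graph
G □ H = record
  { V     = V G × V H
  ; size  = size G * size H
  ; enum  = ↔-trans (enum G ×-↔ enum H) (↔-sym *↔×)
  ; E     = λ { (v , x) (w , y) → (E G v w × x ≡ y) ⊎ (v ≡ w × E H x y) }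
  ; E-sym = λ { (inj₁ (e , refl)) → inj₁ (E-sym G e , refl)
              ; (inj₂ (refl , e)) → inj₂ (refl , E-sym H e) }
  ; E-irr = λ { (inj₁ (e , _)) → E-irr G e ; (inj₂ (_ , e)) → E-irr H e }
  }

_∈V_ : {G : Graph} → V G → Subset (size G) → Set
_∈V_ {G} v B = Inverse.to (enum G) v ∈ₛ B

record TreeDecomposition (G : Graph) : Set₁ where
  field
    T        : Graph
    T-tree   : IsTree T
    bag      : V T → Subset (size G)
    edge-cov : ∀ u v → E G u v → Σ (V T) λ x → (_∈V_ {G} u (bag x)) × (_∈V_ {G} v (bag x))
    vert-nonempty  : ∀ v → Σ (V T) λ x → _∈V_ {G} v (bag x)
    vert-connected : ∀ v → InducedConnected T (λ x → _∈V_ {G} v (bag x))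

open TreeDecomposition public

-- width of a decomposition is max_x |T_x| - 1; "tw(G) ≥ w" means every
-- tree decomposition has width ≥ w, i.e. some bag has |T_x| - 1 ≥ w
TwAtLeast : Graph → ℤ → Set₁
TwAtLeast G w = ∀ (D : TreeDecomposition G) →
  Σ (V (T D)) λ x → w ℤ.≤ (+ ∣ bag D x ∣) ℤ.- + 1

module Submission where

-- Put d = n + 2 − 2k and suppose every bag of a tree decomposition of G □ H has fewer
-- than kd vertices. Read a bag X as a 0/1 matrix with rows V(G) and columns V(H), and call
-- a line light if it contains fewer than k vertices of X. Fewer than d rows are heavy, so at
-- least 2k − 1 rows and, likewise, 2k − 1 columns are light. Let C(X) be the set of vertices
-- outside X lying on a light line. Since G and H are k-connected, one can travel along a
-- light line avoiding X, and counting shows that light lines share free entries; hence C(X)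
-- is connected in G □ H − X. The same count shows that C(X) and C(Y) meet for any two bags.
-- No tree decomposition admits such sets: pointing each node t towards C(bag t) gives a map
-- on the tree with a 2-cycle t, t′, and a vertex of C(bag t) ∩ C(bag t′) would then lie on
-- both sides of the edge t t′.

open import Defs
open import Data.Bool using (Bool; true; false; not; _∨_)
import Data.Bool as Bool
open import Data.Bool.Properties using (not-¬; ¬-not)
open import Data.Empty using (⊥; ⊥-elim)
open import Data.Fin using (Fin; zero; suc; toℕ; _↑ˡ_; _↑ʳ_; combine)
open import Data.Fin.Properties using (pigeonhole; inj⇒≟; any?)
open import Data.Fin.Subset using (Subset; ∣_∣)
open import Data.List using (List; []; _∷_; map; length)
open import Data.List.Properties using (length-map)
open import Data.List.Membership.Propositional using (_∈_)
open import Data.List.Membership.Propositional.Properties using (∈-map⁺; ∈-map⁻)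
open import Data.List.Relation.Unary.Any using (here; there)
open import Data.Nat using (ℕ; zero; suc; pred; _∸_; _≤_; _<_; _<ᵇ_; _≤?_; _<?_; z≤n; s≤s; s≤s⁻¹)
open import Data.Nat.Induction using (<-wellFounded)
open import Data.Nat.Properties using (+-*-semiring)
open import Data.Product using (Σ; ∃; ∃₂; _×_; _,_; proj₁; proj₂)
open import Data.Sum using (_⊎_; inj₁; inj₂)
open import Data.Unit using (⊤; tt)
open import Data.Vec using ([]; _∷_; lookup)
open import Data.Vec.Properties using ([]=⇒lookup)
open import Function using (_∘_)
open import Function.Bundles using (Inverse; Injection)
open import Function.Properties.Inverse using (↔⇒↣)
open import Induction.WellFounded using (Acc; acc)
open import Relation.Binary.Construct.Closure.ReflexiveTransitive using (Star; ε; _◅_; _◅◅_)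
open import Relation.Binary.Definitions using (DecidableEquality; tri<; tri≈; tri>)
open import Relation.Binary.PropositionalEquality
open import Relation.Nullary using (yes; no; ¬_)
open import Relation.Unary using (Decidable)
open import Algebra.Properties.Semiring.Sum +-*-semiring
  using (sum; sum-syntax; sum-cong-≗; ∑-distrib-+; ∑-comm; *-distribˡ-sum; *-distribʳ-sum)

module FiniteSums where

  open import Data.Nat using (_+_; _*_)
  open import Data.Nat.Properties

  𝟙 : Bool → ℕ
  𝟙 true  = 1
  𝟙 false = 0

  ∑-const : ∀ n c → ∑[ i < n ] c ≡ n * c
  ∑-const zero    c = refl
  ∑-const (suc n) c = cong (c +_) (∑-const n c)

  ∑-mono-≤ : ∀ {n} {f g : Fin n → ℕ} → (∀ i → f i ≤ g i) → sum f ≤ sum g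
  ∑-mono-≤ {zero}  f≤g = z≤n
  ∑-mono-≤ {suc n} f≤g = +-mono-≤ (f≤g zero) (∑-mono-≤ (f≤g ∘ suc))

  ∑-<⇒∃-< : ∀ {n} (f g : Fin n → ℕ) → sum f < sum g → ∃ λ i → f i < g i
  ∑-<⇒∃-< {suc n} f g Σf<Σg with f zero <? g zero
  ... | yes f₀<g₀ = zero , f₀<g₀
  ... | no  f₀≮g₀ =
    let i , fᵢ<gᵢ = ∑-<⇒∃-< (f ∘ suc) (g ∘ suc)
                      (+-cancelˡ-< (f zero) _ _ (≤-trans Σf<Σg (+-monoˡ-≤ _ (≮⇒≥ f₀≮g₀))))
    in suc i , fᵢ<gᵢ

  ∑-↑ : ∀ m {n} (f : Fin (m + n) → ℕ) →
    sum f ≡ ∑[ i < m ] f (i ↑ˡ n) + ∑[ j < n ] f (m ↑ʳ j)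
  ∑-↑ zero    f = refl
  ∑-↑ (suc m) f = trans (cong (f zero +_) (∑-↑ m (f ∘ suc))) (sym (+-assoc (f zero) _ _))

  ∑-combine : ∀ m {n} (f : Fin (m * n) → ℕ) →
    sum f ≡ ∑[ i < m ] ∑[ j < n ] f (combine i j)
  ∑-combine zero    f = refl
  ∑-combine (suc m) {n} f =
    trans (∑-↑ n f) (cong (∑[ j < n ] f (j ↑ˡ (m * n)) +_) (∑-combine m (f ∘ (n ↑ʳ_))))

  ∣∣≡∑𝟙 : ∀ {n} (X : Subset n) → ∣ X ∣ ≡ sum (𝟙 ∘ lookup X)
  ∣∣≡∑𝟙 []          = refl
  ∣∣≡∑𝟙 (true  ∷ X) = cong suc (∣∣≡∑𝟙 X)
  ∣∣≡∑𝟙 (false ∷ X) = ∣∣≡∑𝟙 X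

module BooleanMatrices where

  open import Data.Nat using (_+_; _*_)
  open import Data.Nat.Properties
  open import Data.Nat.Tactic.RingSolver using (solve-∀)
  open FiniteSums

  *𝟙[≮ᵇ]≤ : ∀ k s → k * 𝟙 (not (s <ᵇ k)) ≤ s
  *𝟙[≮ᵇ]≤ k s with s <ᵇ k in s<ᵇk
  ... | true  = ≤-trans (≤-reflexive (*-zeroʳ k)) z≤n
  ... | false = ≤-trans (≤-reflexive (*-identityʳ k)) (≮⇒≥ λ s<k → subst Bool.T s<ᵇk (<⇒<ᵇ s<k))

  𝟙[<ᵇ]*≤ : ∀ k s → 𝟙 (s <ᵇ k) * s ≤ 𝟙 (s <ᵇ k) * pred k
  𝟙[<ᵇ]*≤ k s with s <ᵇ k in s<ᵇk
  ... | true  = +-monoˡ-≤ 0 (suc[m]≤n⇒m≤pred[n] (<ᵇ⇒< s k (subst Bool.T (sym s<ᵇk) tt)))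
  ... | false = z≤n

  Matrix : ℕ → ℕ → Set
  Matrix a b = Fin a → Fin b → Bool

  transpose : ∀ {a b} → Matrix a b → Matrix b a
  transpose M j i = M i j

  rowSum : ∀ {a b} → Matrix a b → Fin a → ℕ
  rowSum {b = b} M i = ∑[ j < b ] 𝟙 (M i j)

  colSum : ∀ {a b} → Matrix a b → Fin b → ℕ
  colSum M = rowSum (transpose M)

  isLight : ∀ {a b} → ℕ → Matrix a b → Fin a → Bool
  isLight k M i = rowSum M i <ᵇ k

  lightRows : ∀ {a b} → ℕ → Matrix a b → ℕ
  lightRows k M = sum (𝟙 ∘ isLight k M)

  heavyRows : ∀ {a b} → ℕ → Matrix a b → ℕ
  heavyRows k M = sum (𝟙 ∘ not ∘ isLight k M)

  module _ {a b : ℕ} where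

    heavyRows< : ∀ k d (M : Matrix a b) → sum (rowSum M) < k * d →
      heavyRows k M < d
    heavyRows< k d M total<kd = *-cancelˡ-< k (heavyRows k M) d (begin-strict
      k * heavyRows k M                           ≡⟨ *-distribˡ-sum k (𝟙 ∘ not ∘ isLight k M) ⟩
      ∑[ i < a ] (k * 𝟙 (not (rowSum M i <ᵇ k)))  ≤⟨ ∑-mono-≤ (λ i → *𝟙[≮ᵇ]≤ k (rowSum M i)) ⟩
      sum (rowSum M)                              <⟨ total<kd ⟩
      k * d                                       ∎)
      where open ≤-Reasoning

    rows<lightRows+ : ∀ k d (M : Matrix a b) → sum (rowSum M) < k * d → a < lightRows k M + d
    rows<lightRows+ k d M total<kd = begin-strict
      a                              ≡⟨ split ⟨
      lightRows k M + heavyRows k M  <⟨ +-monoʳ-< _ (heavyRows< k d M total<kd) ⟩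
      lightRows k M + d              ∎
      where
      open ≤-Reasoning
      𝟙+𝟙-not : ∀ b → 𝟙 b + 𝟙 (not b) ≡ 1
      𝟙+𝟙-not true  = refl
      𝟙+𝟙-not false = refl
      split : lightRows k M + heavyRows k M ≡ a
      split = begin-equality
        lightRows k M + heavyRows k M
          ≡⟨ ∑-distrib-+ (𝟙 ∘ isLight k M) (𝟙 ∘ not ∘ isLight k M) ⟨
        ∑[ i < a ] (𝟙 (isLight k M i) + 𝟙 (not (isLight k M i)))
          ≡⟨ sum-cong-≗ (𝟙+𝟙-not ∘ isLight k M) ⟩
        ∑[ i < a ] 1  ≡⟨ ∑-const a 1 ⟩
        a * 1         ≡⟨ *-identityʳ a ⟩
        a             ∎

  isLight⇒< : ∀ {a b} k (M : Matrix a b) i → Bool.T (isLight k M i) → rowSum M i < k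
  isLight⇒< k M i = <ᵇ⇒< (rowSum M i) k

  [g+h]*pred[k]<g*h : ∀ {k g h} → 1 ≤ k → 2 * k ≤ suc g → 2 * k ≤ suc h → (g + h) * pred k < g * h
  [g+h]*pred[k]<g*h {suc k} {g} {h} _ 2k≤1+g 2k≤1+h = begin-strict
    (g + h) * k                      ≡⟨ cong₂ (λ u v → (u + v) * k) k+P≡g k+Q≡h ⟨
    (k + P + (k + Q)) * k            ≡⟨ expand-lhs k P Q ⟩
    (k * P + k * Q + k * k) + k * k  <⟨ +-monoʳ-< _ (*-mono-< (k<∸k 2k≤1+g) (k<∸k 2k≤1+h)) ⟩
    (k * P + k * Q + k * k) + P * Q  ≡⟨ expand-rhs k P Q ⟨
    (k + P) * (k + Q)                ≡⟨ cong₂ _*_ k+P≡g k+Q≡h ⟩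
    g * h                            ∎
    where
    open ≤-Reasoning
    P = g ∸ k
    Q = h ∸ k
    k<∸k : ∀ {m} → 2 * suc k ≤ suc m → k < m ∸ k
    k<∸k {m} le = m+n≤o⇒m≤o∸n (suc k) (≤-trans (≤-reflexive (double k)) (s≤s⁻¹ le))
      where
      double : ∀ k → suc k + k ≡ k + suc (k + 0)
      double = solve-∀
    k≤ : ∀ {m} → 2 * suc k ≤ suc m → k ≤ m
    k≤ le = ≤-trans (m≤m+n k (suc (k + 0))) (s≤s⁻¹ le)
    k+P≡g : k + P ≡ g
    k+P≡g = m+[n∸m]≡n (k≤ 2k≤1+g)
    k+Q≡h : k + Q ≡ h
    k+Q≡h = m+[n∸m]≡n (k≤ 2k≤1+h)
    expand-lhs : ∀ k P Q → (k + P + (k + Q)) * k ≡ (k * P + k * Q + k * k) + k * k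
    expand-lhs = solve-∀
    expand-rhs : ∀ k P Q → (k + P) * (k + Q) ≡ (k * P + k * Q + k * k) + P * Q
    expand-rhs = solve-∀

  𝟙-blocked≤ : ∀ r c p q → 𝟙 r * 𝟙 c * 𝟙 (p ∨ q) ≤ 𝟙 r * 𝟙 p + 𝟙 c * 𝟙 q
  𝟙-blocked≤ true  true  true  q     = s≤s z≤n
  𝟙-blocked≤ true  true  false true  = s≤s z≤n
  𝟙-blocked≤ true  true  false false = z≤n
  𝟙-blocked≤ true  false p     q     = z≤n
  𝟙-blocked≤ false c     p     q     = z≤n

  𝟙-unblocked : ∀ r c p q → 𝟙 r * 𝟙 c * 𝟙 (p ∨ q) < 𝟙 r * 𝟙 c →
    Bool.T r × Bool.T c × p ≡ false × q ≡ false
  𝟙-unblocked true  true  false false _ = tt , tt , refl , refl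
  𝟙-unblocked true  true  true  q     (s≤s ())
  𝟙-unblocked true  true  false true  (s≤s ())
  𝟙-unblocked true  false p     q     ()
  𝟙-unblocked false c     p     q     ()

  ∑-light*rowSum≤ : ∀ {a b} k (M : Matrix a b) →
    ∑[ i < a ] (𝟙 (isLight k M i) * rowSum M i) ≤ lightRows k M * pred k
  ∑-light*rowSum≤ {a} k M = begin
    ∑[ i < a ] (𝟙 (isLight k M i) * rowSum M i) ≤⟨ ∑-mono-≤ (λ i → 𝟙[<ᵇ]*≤ k (rowSum M i)) ⟩
    ∑[ i < a ] (𝟙 (isLight k M i) * pred k)     ≡⟨ *-distribʳ-sum (pred k) (𝟙 ∘ isLight k M) ⟨
    lightRows k M * pred k                      ∎
    where open ≤-Reasoning

  module _ {a b : ℕ} (k : ℕ) where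

    -- Of the R·C entries where a light row of x meets a light column of y, at most
    -- (R + C)(k − 1) are occupied in x or in y.
    light-lines-cross-freely : (x y : Matrix a b) → 1 ≤ k →
      2 * k ≤ suc (lightRows k x) → 2 * k ≤ suc (lightRows k (transpose y)) →
      ∃₂ λ i j → rowSum x i < k × colSum y j < k × x i j ≡ false × y i j ≡ false
    light-lines-cross-freely x y 1≤k many-r many-c =
      let i , blockedᵢ<pairsᵢ = ∑-<⇒∃-< _ _ blocked<pairs
          j , blockedᵢⱼ<pairsᵢⱼ = ∑-<⇒∃-< _ _ blockedᵢ<pairsᵢ
          rᵢ , cⱼ , xᵢⱼ , yᵢⱼ = 𝟙-unblocked (r i) (c j) (x i j) (y i j) blockedᵢⱼ<pairsᵢⱼ
      in i , j , isLight⇒< k x i rᵢ , isLight⇒< k (transpose y) j cⱼ , xᵢⱼ , yᵢⱼ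
      where
      r = isLight k x
      c = isLight k (transpose y)
      R = lightRows k x
      C = lightRows k (transpose y)
      blocked<pairs : ∑[ i < a ] ∑[ j < b ] (𝟙 (r i) * 𝟙 (c j) * 𝟙 (x i j ∨ y i j))
                    < ∑[ i < a ] ∑[ j < b ] (𝟙 (r i) * 𝟙 (c j))
      blocked<pairs = begin-strict
        ∑[ i < a ] ∑[ j < b ] (𝟙 (r i) * 𝟙 (c j) * 𝟙 (x i j ∨ y i j))
          ≤⟨ ∑-mono-≤ (λ i → ∑-mono-≤ (λ j → 𝟙-blocked≤ (r i) (c j) (x i j) (y i j))) ⟩
        ∑[ i < a ] ∑[ j < b ] (𝟙 (r i) * 𝟙 (x i j) + 𝟙 (c j) * 𝟙 (y i j))
          ≡⟨ sum-cong-≗ (λ i → ∑-distrib-+ (λ j → 𝟙 (r i) * 𝟙 (x i j))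
                                           (λ j → 𝟙 (c j) * 𝟙 (y i j))) ⟩
        ∑[ i < a ] (∑[ j < b ] (𝟙 (r i) * 𝟙 (x i j)) + ∑[ j < b ] (𝟙 (c j) * 𝟙 (y i j)))
          ≡⟨ ∑-distrib-+ (λ i → ∑[ j < b ] (𝟙 (r i) * 𝟙 (x i j)))
                         (λ i → ∑[ j < b ] (𝟙 (c j) * 𝟙 (y i j))) ⟩
        ∑[ i < a ] ∑[ j < b ] (𝟙 (r i) * 𝟙 (x i j)) + ∑[ i < a ] ∑[ j < b ] (𝟙 (c j) * 𝟙 (y i j))
          ≡⟨ cong₂ _+_ (sum-cong-≗ (λ i → *-distribˡ-sum (𝟙 (r i)) (λ j → 𝟙 (x i j))))
                       (trans (sum-cong-≗ (λ j → *-distribˡ-sum (𝟙 (c j)) (λ i → 𝟙 (y i j))))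
                              (sym (∑-comm (λ i j → 𝟙 (c j) * 𝟙 (y i j))))) ⟨
        ∑[ i < a ] (𝟙 (r i) * rowSum x i) + ∑[ j < b ] (𝟙 (c j) * colSum y j)
          ≤⟨ +-mono-≤ (∑-light*rowSum≤ k x) (∑-light*rowSum≤ k (transpose y)) ⟩
        R * pred k + C * pred k
          ≡⟨ *-distribʳ-+ (pred k) R C ⟨
        (R + C) * pred k
          <⟨ [g+h]*pred[k]<g*h 1≤k many-r many-c ⟩
        R * C
          ≡⟨ *-distribʳ-sum C (𝟙 ∘ r) ⟩
        ∑[ i < a ] (𝟙 (r i) * C)
          ≡⟨ sum-cong-≗ (λ i → *-distribˡ-sum (𝟙 (r i)) (𝟙 ∘ c)) ⟩
        ∑[ i < a ] ∑[ j < b ] (𝟙 (r i) * 𝟙 (c j)) ∎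
        where open ≤-Reasoning

    light-rows-share-free-light-column : (x : Matrix a b) (i₁ i₂ : Fin a) →
      rowSum x i₁ < k → rowSum x i₂ < k → 2 * k ≤ suc (lightRows k (transpose x)) →
      ∃ λ j → colSum x j < k × x i₁ j ≡ false × x i₂ j ≡ false
    light-rows-share-free-light-column x i₁ i₂ light₁ light₂ many-c =
      let j , blockedⱼ<1 = ∑-<⇒∃-< _ _ blocked<C
          cⱼ , x₁ⱼ , x₂ⱼ = unblocked (c j) (x i₁ j) (x i₂ j) blockedⱼ<1
      in j , isLight⇒< k (transpose x) j cⱼ , x₁ⱼ , x₂ⱼ
      where
      c = isLight k (transpose x)
      C = lightRows k (transpose x)
      blocked≤ : ∀ l p q → 𝟙 l * 𝟙 (p ∨ q) ≤ 𝟙 p + 𝟙 q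
      blocked≤ true  true  q     = s≤s z≤n
      blocked≤ true  false true  = ≤-refl
      blocked≤ true  false false = z≤n
      blocked≤ false p     q     = z≤n
      unblocked : ∀ l p q → 𝟙 l * 𝟙 (p ∨ q) < 𝟙 l → Bool.T l × p ≡ false × q ≡ false
      unblocked true  false false _ = tt , refl , refl
      unblocked true  true  q     (s≤s ())
      unblocked true  false true  (s≤s ())
      unblocked false p     q     ()
      blocked<C : ∑[ j < b ] (𝟙 (c j) * 𝟙 (x i₁ j ∨ x i₂ j)) < ∑[ j < b ] 𝟙 (c j)
      blocked<C = begin-strict
        ∑[ j < b ] (𝟙 (c j) * 𝟙 (x i₁ j ∨ x i₂ j))
          ≤⟨ ∑-mono-≤ (λ j → blocked≤ (c j) (x i₁ j) (x i₂ j)) ⟩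
        ∑[ j < b ] (𝟙 (x i₁ j) + 𝟙 (x i₂ j))
          ≡⟨ ∑-distrib-+ (𝟙 ∘ x i₁) (𝟙 ∘ x i₂) ⟩
        rowSum x i₁ + rowSum x i₂
          <⟨ s≤s⁻¹ (begin
               suc (suc (rowSum x i₁ + rowSum x i₂))  ≡⟨ cong suc (+-suc (rowSum x i₁) (rowSum x i₂)) ⟨
               suc (rowSum x i₁) + suc (rowSum x i₂)  ≤⟨ +-mono-≤ light₁ (≤-trans light₂ (≤-reflexive (sym (+-identityʳ k)))) ⟩
               2 * k                                  ≤⟨ many-c ⟩
               suc C                                  ∎) ⟩
        C ∎
        where open ≤-Reasoning

module Walks where

  enum-injective : (G : Graph) → ∀ {u v} → Inverse.to (enum G) u ≡ Inverse.to (enum G) v → u ≡ v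
  enum-injective G = Injection.injective (↔⇒↣ (enum G))

  decEqᵛ : (G : Graph) → DecidableEquality (V G)
  decEqᵛ G = inj⇒≟ (↔⇒↣ (enum G))

  module _ {G : Graph} where

    mapʷ : ∀ {P Q : V G → Set} → (∀ {x} → P x → Q x) → ∀ {u v} → Walk G P u v → Walk G Q u v
    mapʷ f (here p)     = here (f p)
    mapʷ f (step p e w) = step (f p) e (mapʷ f w)

    infixr 5 _++ʷ_
    _++ʷ_ : ∀ {P u v w} → Walk G P u v → Walk G P v w → Walk G P u w
    here _     ++ʷ w′ = w′
    step p e w ++ʷ w′ = step p e (w ++ʷ w′)

    headʷ : ∀ {P u v} → Walk G P u v → P u
    headʷ (here p)     = p
    headʷ (step p _ _) = p

    reverseʷ : ∀ {P u v} → Walk G P u v → Walk G P v u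
    reverseʷ (here p)     = here p
    reverseʷ (step p e w) = reverseʷ w ++ʷ step (headʷ w) (E-sym G e) (here p)

    toStar : ∀ {P : V G → Set} {R : V G → V G → Set} →
      (∀ {x y} → P x → P y → E G x y → R x y) → ∀ {u v} → Walk G P u v → Star R u v
    toStar f (here _)     = ε
    toStar f (step p e w) = f p (headʷ w) e ◅ toStar f w

    avoid-or-exit : ∀ {P} t {u s} → Walk G P u s → s ≢ t →
      Walk G (_≢ t) u s ⊎ Σ (V G) λ t₁ → E G t t₁ × Walk G (_≢ t) t₁ s
    avoid-or-exit t (here _) s≢t = inj₁ (here s≢t)
    avoid-or-exit t {u} (step _ e w) s≢t with avoid-or-exit t w s≢t | decEqᵛ G u t
    ... | inj₂ exit | _        = inj₂ exit
    ... | inj₁ w′   | yes refl = inj₂ (_ , e , w′)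
    ... | inj₁ w′   | no  u≢t  = inj₁ (step u≢t e w′)

    lastExit : ∀ {P} t {s} → Walk G P t s → s ≢ t →
      Σ (V G) λ t₁ → E G t t₁ × Walk G (_≢ t) t₁ s
    lastExit t w s≢t with avoid-or-exit t w s≢t
    ... | inj₁ w′   = ⊥-elim (headʷ w′ refl)
    ... | inj₂ exit = exit

module Trees where

  open import Data.Nat using (_+_; _*_)
  open import Data.Nat.Properties
  open Walks

  ∃-least : ∀ {P : ℕ → Set} → Decidable P → ∀ {b} → P b →
    ∃ λ m → P m × (∀ {c} → c < m → ¬ P c)
  ∃-least {P} P? Pb = go (<-wellFounded _) Pb
    where
    go : ∀ {b} → Acc _<_ b → P b → ∃ λ m → P m × (∀ {c} → c < m → ¬ P c)
    go {b} (acc rec) Pb with anyUpTo? P? b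
    ... | yes (c , c<b , Pc) = go (rec c<b) Pc
    ... | no  none           = b , Pb , λ c<b Pc → none (_ , c<b , Pc)

  module LoopErasure {A : Set} (_≟_ : DecidableEquality A) {R : A → A → Set} where

    vertexCount : ∀ {x y} → Star R x y → ℕ
    vertexCount ε       = 1
    vertexCount (_ ◅ p) = suc (vertexCount p)

    vertexAt : ∀ {x y} → Star R x y → ℕ → A
    vertexAt {x} ε       _       = x
    vertexAt {x} (_ ◅ p) zero    = x
    vertexAt     (_ ◅ p) (suc i) = vertexAt p i

    _∉ᶜ_ : ∀ {x y} → A → Star R x y → Set
    a ∉ᶜ p = ∀ i → i < vertexCount p → vertexAt p i ≢ a

    Simple : ∀ {x y} → Star R x y → Set
    Simple     ε       = ⊤
    Simple {x} (_ ◅ p) = x ∉ᶜ p × Simple p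

    suffixFrom : ∀ a {x z} (p : Star R x z) → Simple p → (Σ (Star R a z) Simple) ⊎ a ∉ᶜ p
    suffixFrom a {x} ε _ with x ≟ a
    ... | yes refl = inj₁ (ε , tt)
    ... | no  x≢a  = inj₂ λ _ _ → x≢a
    suffixFrom a {x} (r ◅ p) (x∉p , simple) with x ≟ a | suffixFrom a p simple
    ... | yes refl | _           = inj₁ (r ◅ p , x∉p , simple)
    ... | no  _    | inj₁ suffix = inj₁ suffix
    ... | no  x≢a  | inj₂ a∉p    = inj₂ λ { zero _ → x≢a ; (suc i) i<n → a∉p i (s≤s⁻¹ i<n) }

    erase : ∀ {x z} → Star R x z → Σ (Star R x z) Simple
    erase ε = ε , tt
    erase {x} (r ◅ p) with erase p
    ... | q , simple with suffixFrom x q simple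
    ...   | inj₁ suffix = suffix
    ...   | inj₂ x∉q    = r ◅ q , x∉q , simple

    1≤vertexCount : ∀ {x y} (p : Star R x y) → 1 ≤ vertexCount p
    1≤vertexCount ε       = s≤s z≤n
    1≤vertexCount (_ ◅ _) = s≤s z≤n

    vertexAt-0 : ∀ {x y} (p : Star R x y) → vertexAt p 0 ≡ x
    vertexAt-0 ε       = refl
    vertexAt-0 (_ ◅ _) = refl

    vertexAt-last : ∀ {x y} (p : Star R x y) → vertexAt p (vertexCount p ∸ 1) ≡ y
    vertexAt-last ε           = refl
    vertexAt-last (_ ◅ ε)     = refl
    vertexAt-last (_ ◅ r ◅ p) = vertexAt-last (r ◅ p)

    vertexAt-step : ∀ {x y} (p : Star R x y) i → suc i < vertexCount p →
      R (vertexAt p i) (vertexAt p (suc i))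
    vertexAt-step ε       _       (s≤s ())
    vertexAt-step (r ◅ p) zero    _     = subst (R _) (sym (vertexAt-0 p)) r
    vertexAt-step (r ◅ p) (suc i) 2+i<n = vertexAt-step p i (s≤s⁻¹ 2+i<n)

    vertexAt-injective : ∀ {x y} (p : Star R x y) → Simple p → ∀ i j →
      i < vertexCount p → j < vertexCount p → vertexAt p i ≡ vertexAt p j → i ≡ j
    vertexAt-injective ε       _            zero    zero    _     _     _  = refl
    vertexAt-injective ε       _            (suc _) _       (s≤s ()) _    _
    vertexAt-injective ε       _            _       (suc _) _     (s≤s ()) _
    vertexAt-injective (_ ◅ _) _            zero    zero    _     _     _  = refl
    vertexAt-injective (_ ◅ p) (x∉p , _)    zero    (suc j) _     j<n   eq = ⊥-elim (x∉p j (s≤s⁻¹ j<n) (sym eq))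
    vertexAt-injective (_ ◅ p) (x∉p , _)    (suc i) zero    i<n   _     eq = ⊥-elim (x∉p i (s≤s⁻¹ i<n) eq)
    vertexAt-injective (_ ◅ p) (_ , simple) (suc i) (suc j) i<n   j<n   eq =
      cong suc (vertexAt-injective p simple i j (s≤s⁻¹ i<n) (s≤s⁻¹ j<n) eq)

  module _ {T : Graph} (acyclic : Acyclic T) where

    open LoopErasure (decEqᵛ T)

    -- Neither walk uses the edge t t′, so after loop erasure their concatenation closes a
    -- cycle with it.
    acyclic-edge-separates : ∀ {t t' s} → E T t t' → Walk T (_≢ t) t' s → Walk T (_≢ t') t s → ⊥
    acyclic-edge-separates {t} {t'} e w w' = acyclic cycle
      where
      OtherEdge : V T → V T → Set
      OtherEdge x y = E T x y × ¬ (x ≡ t × y ≡ t') × ¬ (x ≡ t' × y ≡ t)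
      chain : Star OtherEdge t' t
      chain = toStar (λ x≢t y≢t e → e , x≢t ∘ proj₁ , y≢t ∘ proj₂) w
           ◅◅ toStar (λ x≢t' y≢t' e → e , y≢t' ∘ proj₂ , x≢t' ∘ proj₁) (reverseʷ w')
      path : Star OtherEdge t' t
      path = proj₁ (erase chain)
      3≤vertexCount : (q : Star OtherEdge t' t) → 3 ≤ vertexCount q
      3≤vertexCount ε           = ⊥-elim (E-irr T e)
      3≤vertexCount (r ◅ ε)     = ⊥-elim (proj₂ (proj₂ r) (refl , refl))
      3≤vertexCount (_ ◅ _ ◅ q) = s≤s (s≤s (1≤vertexCount q))
      cycle : Cycle T
      cycle = record
        { L       = vertexCount path
        ; 3≤L     = 3≤vertexCount path
        ; c       = vertexAt path
        ; c-inj   = vertexAt-injective path (proj₂ (erase chain))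
        ; c-step  = λ i i<L → proj₁ (vertexAt-step path i i<L)
        ; c-close = subst₂ (E T) (sym (vertexAt-last path)) (sym (vertexAt-0 path)) e
        }

    module _ (p : V T → V T) (p-adj : ∀ t → E T t (p t)) (t₀ : V T) where

      private
        orbit : ℕ → V T
        orbit zero    = t₀
        orbit (suc i) = p (orbit i)

        Repeat : ℕ → Set
        Repeat b = ∃ λ a → a < b × orbit a ≡ orbit b

        repeat? : Decidable Repeat
        repeat? b = anyUpTo? (λ a → decEqᵛ T (orbit a) (orbit b)) b

        some-repeat : ∃ Repeat
        some-repeat with i , j , i<j , eq ← pigeonhole (n<1+n (size T)) (Inverse.to (enum T) ∘ orbit ∘ toℕ)
          = toℕ j , toℕ i , i<j , enum-injective T eq

        -- Minimality makes orbit a, …, orbit (a + o + 1) distinct, so for o ≥ 2 they form a cycle.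
        first-repeat : ∀ a o → orbit a ≡ orbit (suc a + o) → (∀ {c} → c < suc a + o → ¬ Repeat c) →
          Σ (V T) λ t → p (p t) ≡ t
        first-repeat a zero eq _ =
          ⊥-elim (E-irr T (subst (E T (orbit a)) (trans (cong (p ∘ orbit) (sym (+-identityʳ a))) (sym eq))
                                 (p-adj (orbit a))))
        first-repeat a (suc zero) eq _ = orbit a , sym (trans eq (cong (p ∘ orbit) (+-comm a 1)))
        first-repeat a (suc (suc o)) eq minimal = ⊥-elim (acyclic cycle)
          where
          c : ℕ → V T
          c i = orbit (a + i)
          no-earlier : ∀ {i j} → i < j → j < 3 + o → c i ≢ c j
          no-earlier {i} {j} i<j j<L cᵢ≡cⱼ =
            minimal (s≤s (+-monoʳ-≤ a (s≤s⁻¹ j<L))) (a + i , +-monoʳ-< a i<j , cᵢ≡cⱼ)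
          c-inj : ∀ i j → i < 3 + o → j < 3 + o → c i ≡ c j → i ≡ j
          c-inj i j i<L j<L cᵢ≡cⱼ with <-cmp i j
          ... | tri< i<j _ _ = ⊥-elim (no-earlier i<j j<L cᵢ≡cⱼ)
          ... | tri≈ _ i≡j _ = i≡j
          ... | tri> _ _ j<i = ⊥-elim (no-earlier j<i i<L (sym cᵢ≡cⱼ))
          cycle : Cycle T
          cycle = record
            { L       = 3 + o
            ; 3≤L     = s≤s (s≤s (s≤s z≤n))
            ; c       = c
            ; c-inj   = c-inj
            ; c-step  = λ i _ → subst (E T (c i)) (cong orbit (sym (+-suc a i))) (p-adj (c i))
            ; c-close = subst (E T (c (2 + o))) (trans (sym eq) (cong orbit (sym (+-identityʳ a))))
                              (p-adj (c (2 + o)))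
            }

      neighbourMap-2-cycle : Σ (V T) λ t → p (p t) ≡ t
      neighbourMap-2-cycle
        with b , (a , a<b , eq) , minimal ← ∃-least repeat? (proj₂ some-repeat)
        with o , refl ← m≤n⇒∃[o]m+o≡n a<b
        = first-repeat a o eq minimal

module TreeDecompositions where

  open Walks
  open Trees

  module _ {G : Graph} (D : TreeDecomposition G) where

    _∉bag_ : V G → V (T D) → Set
    v ∉bag t = ¬ (_∈V_ {G} v (bag D t))

    avoiding-walk⇒tree-walk : ∀ t {u v} → Walk G (_∉bag t) u v → ∀ {s₁ s₂} →
      _∈V_ {G} u (bag D s₁) → _∈V_ {G} v (bag D s₂) → Walk (T D) (_≢ t) s₁ s₂
    avoiding-walk⇒tree-walk t {u} (here u∉t) u∈s₁ u∈s₂ =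
      mapʷ (λ u∈x x≡t → u∉t (subst (λ x → _∈V_ {G} u (bag D x)) x≡t u∈x))
           (vert-connected D u _ _ u∈s₁ u∈s₂)
    avoiding-walk⇒tree-walk t (step u∉t e w) u∈s₁ y∈s₂
      with r , u∈r , y∈r ← edge-cov D _ _ e
      = avoiding-walk⇒tree-walk t (here u∉t) u∈s₁ u∈r ++ʷ avoiding-walk⇒tree-walk t w y∈r y∈s₂

    -- The easy half of the bramble duality: sets C t, each connected in G minus bag t,
    -- with C t and C t' touching for adjacent t, t', cannot exist.
    module _ (C : V (T D) → V G → Set) (nonempty : ∀ t → Σ (V G) (C t))
             (connected : ∀ t {u v} → C t u → C t v → Walk G (_∉bag t) u v) where

      private
        pick : V (T D) → V G
        pick t = proj₁ (nonempty t)

        home : V (T D) → V (T D)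
        home t = proj₁ (vert-nonempty D (pick t))

        pick∈home : ∀ t → _∈V_ {G} (pick t) (bag D (home t))
        pick∈home t = proj₂ (vert-nonempty D (pick t))

        home≢t : ∀ t → home t ≢ t
        home≢t t home≡t = headʷ (connected t (proj₂ (nonempty t)) (proj₂ (nonempty t)))
                            (subst (λ x → _∈V_ {G} (pick t) (bag D x)) home≡t (pick∈home t))

        exit : ∀ t → Σ (V (T D)) λ t₁ → E (T D) t t₁ × Walk (T D) (_≢ t) t₁ (home t)
        exit t = lastExit t (proj₂ (proj₁ (T-tree D)) t (home t) tt tt) (home≢t t)

        p : V (T D) → V (T D)
        p t = proj₁ (exit t)

        toward : ∀ t {c s} → C t c → _∈V_ {G} c (bag D s) → Walk (T D) (_≢ t) (p t) s
        toward t c∈Cₜ c∈s = proj₂ (proj₂ (exit t))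
          ++ʷ avoiding-walk⇒tree-walk t (connected t (proj₂ (nonempty t)) c∈Cₜ) (pick∈home t) c∈s

      no-touching-escapes : (∀ {t t'} → E (T D) t t' → Σ (V G) λ v → C t v × C t' v) → ⊥
      no-touching-escapes touch =
        let acyclic      = proj₂ (T-tree D)
            root         = proj₁ (proj₁ (proj₁ (T-tree D)))
            t , pp≡t     = neighbourMap-2-cycle acyclic p (proj₁ ∘ proj₂ ∘ exit) root
            t~pt         = proj₁ (proj₂ (exit t))
            v , v∈Cₜ , v∈Cₚₜ = touch t~pt
            s , v∈s      = vert-nonempty D v
        in acyclic-edge-separates acyclic t~pt (toward t v∈Cₜ v∈s)
             (subst (λ x → Walk (T D) (_≢ p t) x s) pp≡t (toward (p t) v∈Cₚₜ v∈s))

module KConnectivity where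

  open FiniteSums
  open Walks

  trues : ∀ {n} → (Fin n → Bool) → List (Fin n)
  trues {zero}  f = []
  trues {suc n} f with f zero
  ... | true  = zero ∷ map suc (trues (f ∘ suc))
  ... | false = map suc (trues (f ∘ suc))

  length-trues : ∀ {n} (f : Fin n → Bool) → length (trues f) ≡ sum (𝟙 ∘ f)
  length-trues {zero}  f = refl
  length-trues {suc n} f with f zero
  ... | true  = cong suc (trans (length-map suc (trues (f ∘ suc))) (length-trues (f ∘ suc)))
  ... | false = trans (length-map suc (trues (f ∘ suc))) (length-trues (f ∘ suc))

  ∈-trues⁺ : ∀ {n} (f : Fin n → Bool) {i} → f i ≡ true → i ∈ trues f
  ∈-trues⁺ {suc n} f {zero} f₀ with f zero | f₀
  ... | true | _ = here refl
  ∈-trues⁺ {suc n} f {suc i} fᵢ with f zero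
  ... | true  = there (∈-map⁺ suc (∈-trues⁺ (f ∘ suc) fᵢ))
  ... | false = ∈-map⁺ suc (∈-trues⁺ (f ∘ suc) fᵢ)

  ∈-trues⁻ : ∀ {n} (f : Fin n → Bool) {i} → i ∈ trues f → f i ≡ true
  ∈-suc-trues⁻ : ∀ {n} (f : Fin (suc n) → Bool) {i} → i ∈ map suc (trues (f ∘ suc)) → f i ≡ true

  ∈-trues⁻ {suc n} f i∈ with f zero in f₀
  ∈-trues⁻ {suc n} f (here refl) | true  = f₀
  ∈-trues⁻ {suc n} f (there i∈)  | true  = ∈-suc-trues⁻ f i∈
  ∈-trues⁻ {suc n} f i∈          | false = ∈-suc-trues⁻ f i∈

  ∈-suc-trues⁻ f i∈ with j , j∈ , refl ← ∈-map⁻ suc i∈ = ∈-trues⁻ (f ∘ suc) j∈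

  KConnected⇒unmarked-connected : ∀ {k K} → KConnected k K → (marked : Fin (size K) → Bool) →
    sum (𝟙 ∘ marked) < k → InducedConnected K (λ w → marked (Inverse.to (enum K) w) ≡ false)
  KConnected⇒unmarked-connected {k} {K} (_ , connected) marked few u v u-free v-free =
    mapʷ unmarked (connected S ∣S∣<k u v (∉S u-free) (∉S v-free))
    where
    open Inverse (enum K)
    S : List (V K)
    S = map from (trues marked)
    ∣S∣<k : length S < k
    ∣S∣<k = subst (_< k) (sym (trans (length-map from (trues marked)) (length-trues marked))) few
    ∉S : ∀ {w} → marked (to w) ≡ false → ¬ (w ∈ S)
    ∉S w-free w∈S with i , i∈ , refl ← ∈-map⁻ from w∈S =
      not-¬ (trans (cong marked (strictlyInverseˡ i)) (∈-trues⁻ marked i∈)) w-free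
    unmarked : ∀ {w} → ¬ (w ∈ S) → marked (to w) ≡ false
    unmarked {w} w∉S = ¬-not λ w-marked →
      w∉S (subst (_∈ S) (strictlyInverseʳ w) (∈-map⁺ from (∈-trues⁺ marked w-marked)))

module Products where

  open import Data.Nat using (_+_; _*_)
  open import Data.Nat.Properties
  open import Data.Nat.Tactic.RingSolver using (solve-∀)
  open FiniteSums
  open BooleanMatrices
  open Walks
  open TreeDecompositions
  open KConnectivity

  module _ {G H : Graph} where

    rowʷ : ∀ {Q : V (G □ H) → Set} g {h₁ h₂} →
      Walk H (λ h → Q (g , h)) h₁ h₂ → Walk (G □ H) Q (g , h₁) (g , h₂)
    rowʷ g (here q)     = here q
    rowʷ g (step q e w) = step q (inj₂ (refl , e)) (rowʷ g w)

    columnʷ : ∀ {Q : V (G □ H) → Set} h {g₁ g₂} →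
      Walk G (λ g → Q (g , h)) g₁ g₂ → Walk (G □ H) Q (g₁ , h) (g₂ , h)
    columnʷ h (here q)     = here q
    columnʷ h (step q e w) = step q (inj₁ (e , refl)) (columnʷ h w)

  2k≤1+light : ∀ {a d k n L} → a < L + d → d + 2 * k ≤ n + 2 → n ≤ a → 2 * k ≤ suc L
  2k≤1+light {a} {d} {k} {n} {L} a<L+d d+2k≤n+2 n≤a = +-cancelˡ-≤ d _ _ (begin
    d + 2 * k      ≤⟨ d+2k≤n+2 ⟩
    n + 2          ≤⟨ +-monoˡ-≤ 2 n≤a ⟩
    a + 2          ≡⟨ +-suc a 1 ⟩
    suc a + 1      ≤⟨ +-monoˡ-≤ 1 a<L+d ⟩
    L + d + 1      ≡⟨ rearrange L d ⟩
    d + suc L      ∎)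
    where
    open ≤-Reasoning
    rearrange : ∀ L d → L + d + 1 ≡ d + suc L
    rearrange = solve-∀

  module Grid (k : ℕ) {G H : Graph} (kG : KConnected k G) (kH : KConnected k H) where

    private
      module EG = Inverse (enum G)
      module EH = Inverse (enum H)

    Bag : Set
    Bag = Subset (size G * size H)

    matrix : Bag → Matrix (size G) (size H)
    matrix X i j = lookup X (combine i j)

    Free : Bag → V (G □ H) → Set
    Free X (g , h) = matrix X (EG.to g) (EH.to h) ≡ false

    Free⇒∉ : ∀ X {w} → Free X w → ¬ (_∈V_ {G □ H} w X)
    Free⇒∉ X free w∈X = not-¬ ([]=⇒lookup w∈X) free

    LightRow : Bag → V G → Set
    LightRow X g = rowSum (matrix X) (EG.to g) < k

    LightColumn : Bag → V H → Set
    LightColumn X h = colSum (matrix X) (EH.to h) < k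

    Escape : Bag → V (G □ H) → Set
    Escape X (g , h) = Free X (g , h) × (LightRow X g ⊎ LightColumn X h)

    ManyLight : Bag → Set
    ManyLight X = 2 * k ≤ suc (lightRows k (matrix X)) × 2 * k ≤ suc (lightRows k (transpose (matrix X)))

    free-at : ∀ X {i j} → matrix X i j ≡ false → Free X (EG.from i , EH.from j)
    free-at X {i} {j} = subst₂ (λ i′ j′ → matrix X i′ j′ ≡ false)
                               (sym (EG.strictlyInverseˡ i)) (sym (EH.strictlyInverseˡ j))

    lightRow-at : ∀ X {i} → rowSum (matrix X) i < k → LightRow X (EG.from i)
    lightRow-at X {i} = subst (λ i′ → rowSum (matrix X) i′ < k) (sym (EG.strictlyInverseˡ i))

    lightColumn-at : ∀ X {j} → colSum (matrix X) j < k → LightColumn X (EH.from j)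
    lightColumn-at X {j} = subst (λ j′ → colSum (matrix X) j′ < k) (sym (EH.strictlyInverseˡ j))

    lightRow-walk : ∀ X {g h₁ h₂} → LightRow X g → Free X (g , h₁) → Free X (g , h₂) →
      Walk (G □ H) (Free X) (g , h₁) (g , h₂)
    lightRow-walk X {g} {h₁} {h₂} light free₁ free₂ =
      rowʷ g (KConnected⇒unmarked-connected kH (matrix X (EG.to g)) light h₁ h₂ free₁ free₂)

    lightColumn-walk : ∀ X {h g₁ g₂} → LightColumn X h → Free X (g₁ , h) → Free X (g₂ , h) →
      Walk (G □ H) (Free X) (g₁ , h) (g₂ , h)
    lightColumn-walk X {h} {g₁} {g₂} light free₁ free₂ =
      columnʷ h (KConnected⇒unmarked-connected kG (λ i → matrix X i (EH.to h)) light g₁ g₂ free₁ free₂)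

    module _ (X : Bag) (many : ManyLight X) where

      reach-lightColumn : ∀ {w} → Escape X w →
        Σ (V (G □ H)) λ z → LightColumn X (proj₂ z) × Free X z × Walk (G □ H) (Free X) w z
      reach-lightColumn {g , h} (free , inj₂ light) = (g , h) , light , free , here free
      reach-lightColumn {g , h} (free , inj₁ light) =
        let j , lightⱼ , free-gj , _ =
              light-rows-share-free-light-column k (matrix X) (EG.to g) (EG.to g) light light (proj₂ many)
            free′ = subst (λ j′ → matrix X (EG.to g) j′ ≡ false) (sym (EH.strictlyInverseˡ j)) free-gj
        in (g , EH.from j) , lightColumn-at X lightⱼ , free′ , lightRow-walk X light free free′

      lightColumns-connected : ∀ {g₁ h₁ g₂ h₂} →
        LightColumn X h₁ → Free X (g₁ , h₁) → LightColumn X h₂ → Free X (g₂ , h₂) →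
        Walk (G □ H) (Free X) (g₁ , h₁) (g₂ , h₂)
      lightColumns-connected {g₁} {h₁} {g₂} {h₂} light₁ free₁ light₂ free₂ =
        let i , lightᵢ , free-ih₁ , free-ih₂ =
              light-rows-share-free-light-column k (transpose (matrix X)) (EH.to h₁) (EH.to h₂)
                light₁ light₂ (proj₁ many)
            free₁′ = subst (λ i′ → matrix X i′ (EH.to h₁) ≡ false) (sym (EG.strictlyInverseˡ i)) free-ih₁
            free₂′ = subst (λ i′ → matrix X i′ (EH.to h₂) ≡ false) (sym (EG.strictlyInverseˡ i)) free-ih₂
        in lightColumn-walk X light₁ free₁ free₁′
           ++ʷ lightRow-walk X (lightRow-at X lightᵢ) free₁′ free₂′
           ++ʷ reverseʷ (lightColumn-walk X light₂ free₂ free₂′)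

      escape-connected : ∀ {u v} → Escape X u → Escape X v → Walk (G □ H) (Free X) u v
      escape-connected u∈ v∈ =
        let _ , light₁ , free₁ , u⇝z₁ = reach-lightColumn u∈
            _ , light₂ , free₂ , v⇝z₂ = reach-lightColumn v∈
        in u⇝z₁ ++ʷ lightColumns-connected light₁ free₁ light₂ free₂ ++ʷ reverseʷ v⇝z₂

    escapes-touch : 1 ≤ k → ∀ X Y → ManyLight X → ManyLight Y →
      Σ (V (G □ H)) λ w → Escape X w × Escape Y w
    escapes-touch 1≤k X Y manyX manyY =
      let i , j , lightᵢ , lightⱼ , free-X , free-Y =
            light-lines-cross-freely k (matrix X) (matrix Y) 1≤k (proj₁ manyX) (proj₂ manyY)
      in (EG.from i , EH.from j) , (free-at X free-X , inj₁ (lightRow-at X lightᵢ))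
                                , (free-at Y free-Y , inj₂ (lightColumn-at Y lightⱼ))

    small⇒ManyLight : ∀ {d n} X → ∣ X ∣ < k * d → d + 2 * k ≤ n + 2 → n ≤ size G → n ≤ size H →
      ManyLight X
    small⇒ManyLight {d} X ∣X∣<kd d+2k≤n+2 n≤∣G∣ n≤∣H∣ =
        2k≤1+light {k = k} (rows<lightRows+ k d (matrix X) rows<kd) d+2k≤n+2 n≤∣G∣
      , 2k≤1+light {k = k} (rows<lightRows+ k d (transpose (matrix X)) columns<kd) d+2k≤n+2 n≤∣H∣
      where
      ∣X∣≡∑rows : ∣ X ∣ ≡ sum (rowSum (matrix X))
      ∣X∣≡∑rows = trans (∣∣≡∑𝟙 X) (∑-combine (size G) (𝟙 ∘ lookup X))
      rows<kd : sum (rowSum (matrix X)) < k * d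
      rows<kd = subst (_< k * d) ∣X∣≡∑rows ∣X∣<kd
      columns<kd : sum (colSum (matrix X)) < k * d
      columns<kd = subst (_< k * d) (∑-comm (λ i j → 𝟙 (matrix X i j))) rows<kd

  large-bag : ∀ {G H} k d {n} → 1 ≤ k → KConnected k G → KConnected k H →
    d + 2 * k ≤ n + 2 → n ≤ size G → n ≤ size H →
    (D : TreeDecomposition (G □ H)) → Σ (V (T D)) λ x → k * d ≤ ∣ bag D x ∣
  large-bag {G} {H} k d 1≤k kG kH d+2k≤n+2 n≤∣G∣ n≤∣H∣ D
    with any? (λ i → k * d ≤? ∣ bag D (Inverse.from (enum (T D)) i) ∣)
  ... | yes (i , large) = Inverse.from (enum (T D)) i , large
  ... | no  none        =
    ⊥-elim (no-touching-escapes D (Escape ∘ bag D) nonempty connected touch)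
    where
    open Grid k kG kH
    small : ∀ t → ∣ bag D t ∣ < k * d
    small t = ≰⇒> λ large → none (Inverse.to (enum (T D)) t ,
      subst (λ x → k * d ≤ ∣ bag D x ∣) (sym (Inverse.strictlyInverseʳ (enum (T D)) t)) large)
    many : ∀ t → ManyLight (bag D t)
    many t = small⇒ManyLight (bag D t) (small t) d+2k≤n+2 n≤∣G∣ n≤∣H∣
    touch : ∀ {t t'} → E (T D) t t' → Σ (V (G □ H)) λ w → Escape (bag D t) w × Escape (bag D t') w
    touch {t} {t'} _ = escapes-touch 1≤k (bag D t) (bag D t') (many t) (many t')
    nonempty : ∀ t → Σ (V (G □ H)) (Escape (bag D t))
    nonempty t = let w , escape , _ = escapes-touch 1≤k (bag D t) (bag D t) (many t) (many t) in w , escape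
    connected : ∀ t {u v} → Escape (bag D t) u → Escape (bag D t) v → Walk (G □ H) (λ w → _∉bag_ D w t) u v
    connected t u∈ v∈ = mapʷ (Free⇒∉ (bag D t)) (escape-connected (bag D t) (many t) u∈ v∈)

module IntegerBound where

  open import Data.Integer as ℤ using (+_; -_; _⊖_)
  import Data.Integer.Properties as ℤ
  open import Data.Integer.Tactic.RingSolver using (solve-∀)
  open import Data.Nat using (_+_; _*_)
  open import Data.Nat.Properties

  n-2k+2≡⊖ : ∀ k n → (+ n) ℤ.- (+ 2) ℤ.* (+ k) ℤ.+ (+ 2) ≡ (n + 2) ⊖ (2 * k)
  n-2k+2≡⊖ k n = begin
    + n ℤ.- + 2 ℤ.* + k ℤ.+ + 2     ≡⟨ regroup (+ n) (+ k) ⟩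
    (+ n ℤ.+ + 2) ℤ.- + 2 ℤ.* + k   ≡⟨ cong₂ ℤ._-_ (ℤ.pos-+ n 2) (ℤ.pos-* 2 k) ⟨
    + (n + 2) ℤ.- + (2 * k)         ≡⟨ ℤ.m-n≡m⊖n (n + 2) (2 * k) ⟩
    (n + 2) ⊖ (2 * k)               ∎
    where
    open ≡-Reasoning
    regroup : ∀ a b → a ℤ.- + 2 ℤ.* b ℤ.+ + 2 ≡ (a ℤ.+ + 2) ℤ.- + 2 ℤ.* b
    regroup = solve-∀

  k[n-2k+2]≡ : ∀ {k n} → 2 * k ≤ n + 2 →
    (+ k) ℤ.* ((+ n) ℤ.- (+ 2) ℤ.* (+ k) ℤ.+ (+ 2)) ≡ + (k * (n + 2 ∸ 2 * k))
  k[n-2k+2]≡ {k} {n} 2k≤n+2 =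
    trans (cong ((+ k) ℤ.*_) (trans (n-2k+2≡⊖ k n) (ℤ.⊖-≥ 2k≤n+2))) (sym (ℤ.pos-* k _))

  k[n-2k+2]≤0 : ∀ {k n} → ¬ (2 * k ≤ n + 2) →
    (+ k) ℤ.* ((+ n) ℤ.- (+ 2) ℤ.* (+ k) ℤ.+ (+ 2)) ℤ.≤ + 0
  k[n-2k+2]≤0 {k} {n} 2k≰n+2 = subst (ℤ._≤ + 0) (sym negative) ℤ.neg-≤-pos
    where
    negative : (+ k) ℤ.* ((+ n) ℤ.- (+ 2) ℤ.* (+ k) ℤ.+ (+ 2)) ≡ - + (k * (2 * k ∸ (n + 2)))
    negative = trans (cong ((+ k) ℤ.*_) (trans (n-2k+2≡⊖ k n) (ℤ.⊖-< (≰⇒> 2k≰n+2))))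
                     (trans (sym (ℤ.neg-distribʳ-* (+ k) _)) (cong -_ (sym (ℤ.pos-* k _))))

open import Data.Nat using (ℕ; _≤_)
open import Data.Integer using (+_; _-_; _*_; _+_)
open import Data.Product using (_×_)
open import Data.Integer using (-_; +≤+)
import Data.Integer.Properties as ℤ
import Data.Nat as ℕ
import Data.Nat.Properties as ℕₚ

open Products using (large-bag)
open IntegerBound using (k[n-2k+2]≡; k[n-2k+2]≤0)

mainTheorem1 : (k n : ℕ) → 1 ≤ k → 1 ≤ n → (G H : Graph) →
    KConnected k G → KConnected k H → n ≤ ∣V∣ G → n ≤ ∣V∣ H →
    TwAtLeast (G □ H) ((+ k) * ((+ n) - (+ 2) * (+ k) + (+ 2)) - (+ 1))
mainTheorem1 k n 1≤k _ G H kG kH n≤∣G∣ n≤∣H∣ D with 2 ℕ.* k ≤? n ℕ.+ 2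
... | yes 2k≤n+2 =
  let x , large = large-bag k (n ℕ.+ 2 ∸ 2 ℕ.* k) 1≤k kG kH
                    (ℕₚ.≤-reflexive (ℕₚ.m∸n+n≡m 2k≤n+2)) n≤∣G∣ n≤∣H∣ D
  in x , ℤ.+-monoˡ-≤ (- (+ 1)) (ℤ.≤-trans (ℤ.≤-reflexive (k[n-2k+2]≡ {k} {n} 2k≤n+2)) (+≤+ large))
... | no 2k≰n+2 =
  let root = proj₁ (proj₁ (proj₁ (T-tree D)))
  in root , ℤ.+-monoˡ-≤ (- (+ 1))
               (ℤ.≤-trans (k[n-2k+2]≤0 {k} {n} 2k≰n+2) (+≤+ (z≤n {∣ bag D root ∣})))
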